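{- Let $A$ be a commutative unitary $\mathbb{Q}$-algebra (so $\mathbb{Q}$ is viewed inside $A$ via the structure map). Suppose there is a set $T\subseteq\mathbb{Q}$ such that (i) $T$ is Diophantine over $A$, and (ii) the set $S=T\cap\mathbb{N}$ satisfies $\delta_*(S)>0$. Then $\mathbb{Q}$ is Diophantine in $A$.
   Context: A set $S\subseteq A^m$ is Diophantine over $A$ if there are polynomials $F_1,\dots,F_r\in A[x_1,\dots,x_m,y_1,\dots,y_n]$ such that for every $\mathbf{a}\in A^m$: $\mathbf{a}\in S$ if and only if the equations $F_j(\mathbf{a},\mathbf{y})=0$ have a common solution $\mathbf{y}\in A^n$. $\mathbb{N}=\{0,1,2,\dots\}$ and the lower density is $\delta_*(S)=\liminf_{x\to\infty}\frac{1}{x}\#\{n\in S:n\le x\}$. -}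

module Defs where

open import Level using (Level; _⊔_; suc)
open import Algebra.Bundles using (CommutativeRing)
open import Algebra.Morphism.Structures using (module RingMorphisms)
open import Data.Rational.Base using (ℚ; _/_) renaming (+-*-rawRing to ℚ-rawRing)
open import Data.Integer.Base using (+_)
open import Data.Nat.Base using (ℕ; _≤_; _*_)
open import Data.Fin.Base using (Fin)
open import Data.Sum.Base using (_⊎_; [_,_])
open import Data.Product.Base using (Σ; ∃; _×_)
open import Data.List.Base using (List; length)
open import Data.List.Relation.Unary.All using (All)
open import Data.List.Relation.Unary.Unique.Propositional using (Unique)
open import Relation.Binary.PropositionalEquality using (_≡_)

record ℚAlgebra (c ℓ : Level) : Set (suc (c ⊔ ℓ)) where
  field
    commRing : CommutativeRing c ℓ
  open CommutativeRing commRing public hiding (ring)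
  field
    ι : ℚ → Carrier
    ι-isRingHom : RingMorphisms.IsRingHomomorphism ℚ-rawRing rawRing ι

-- Polynomial expressions over a commutative ring R in the variables of type V.
-- Every element of R[V] is represented by such an expression.
data Poly {c ℓ} (R : CommutativeRing c ℓ) (V : Set) : Set c where
  con  : CommutativeRing.Carrier R → Poly R V
  var  : V → Poly R V
  _⊕_  : Poly R V → Poly R V → Poly R V
  _⊗_  : Poly R V → Poly R V → Poly R V
  ⊝_   : Poly R V → Poly R V

eval : ∀ {c ℓ} (R : CommutativeRing c ℓ) {V : Set} →
       (V → CommutativeRing.Carrier R) → Poly R V → CommutativeRing.Carrier R
eval R ρ (con a) = a
eval R ρ (var v) = ρ v
eval R ρ (p ⊕ q) = CommutativeRing._+_ R (eval R ρ p) (eval R ρ q)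
eval R ρ (p ⊗ q) = CommutativeRing._*_ R (eval R ρ p) (eval R ρ q)
eval R ρ (⊝ p)   = CommutativeRing.-_ R (eval R ρ p)

Diophantine : ∀ {c ℓ p} (R : CommutativeRing c ℓ) (m : ℕ) →
              ((Fin m → CommutativeRing.Carrier R) → Set p) → Set (c ⊔ ℓ ⊔ p)
Diophantine R m S =
  Σ ℕ λ n → Σ ℕ λ r → Σ (Fin r → Poly R (Fin m ⊎ Fin n)) λ F →
    ∀ (a : Fin m → Carrier) →
      (S a → Σ (Fin n → Carrier) λ y → ∀ j → eval R [ a , y ] (F j) ≈ 0#)
      × (Σ (Fin n → Carrier) (λ y → ∀ j → eval R [ a , y ] (F j) ≈ 0#) → S a)
  where open CommutativeRing R

ImageIn : ∀ {c ℓ t} (A : ℚAlgebra c ℓ) → (ℚ → Set t) →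
          (Fin 1 → ℚAlgebra.Carrier A) → Set (ℓ ⊔ t)
ImageIn A T a = Σ ℚ λ q → T q × (ℚAlgebra._≈_ A (ℚAlgebra.ι A q) (a Fin.zero))
  where import Data.Fin.Base as Fin

ℕ→ℚ : ℕ → ℚ
ℕ→ℚ n = (+ n) / 1

AtLeastUpTo : ∀ {s} → (ℕ → Set s) → ℕ → ℕ → Set s
AtLeastUpTo S x k = Σ (List ℕ) λ l → Unique l × All (λ n → n ≤ x × S n) l × k ≤ length l

-- Positive lower density δ_*(S) > 0, i.e. liminf_{x→∞} #{n∈S, n≤x}/x > 0,
-- equivalently: there are a, b with a > 0 and N such that for all x ≥ N,
-- #{n ∈ S : n ≤ x} · b ≥ a · x  (i.e. the ratio is eventually ≥ a/b > 0).
PositiveLowerDensity : ∀ {s} → (ℕ → Set s) → Set s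
PositiveLowerDensity S =
  Σ ℕ λ a → Σ ℕ λ b → Σ ℕ λ N → (1 ≤ a) ×
    (∀ x → N ≤ x → Σ ℕ λ k → AtLeastUpTo S x k × (a * x ≤ b * k))

-- If S ⊆ ℕ has positive lower density, then for any P and D there is c ≥ 1 such that cP
-- and cD are both differences of elements of S: the (K + 1)·|S ∩ [0, x]|² points
-- (s + jP, s′ + jD) with 0 ≤ j ≤ K and s, s′ ∈ S ∩ [0, x] lie in a box of about x² points,
-- so for K large compared with the inverse density two of them coincide, and c = |j − j′|.
-- With P = |numerator q| and D = denominator q this writes every rational q as
-- (t₀ − t₁)/(t₂ − t₃) with tᵢ ∈ T. Hence a ∈ A is rational iff there are y₀, …, y₃ ∈ T and
-- w with (y₂ − y₃)w = 1 and a(y₂ − y₃) = y₀ − y₁ (if the yᵢ come from rationals with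
-- t₂ = t₃, the first equation forces 1 = 0 in A, where a = 0 is rational), and this
-- condition is Diophantine because T is.
module Submission where

open import Defs
open import Level using (Level; _⊔_)
open import Algebra.Bundles using (CommutativeRing)
open import Algebra.Morphism.Structures using (module RingMorphisms)
open import Data.Empty using (⊥-elim)
open import Data.Fin.Base using (Fin; toℕ; fromℕ<)
import Data.Fin.Properties as Fin
open import Data.Fin.Patterns using (0F; 1F; 2F; 3F)
open import Data.List.Base as List using (List; length)
open import Data.Nat.Base as ℕ using (ℕ; suc; z≤n; s≤s)
open import Data.Product.Base using (Σ; ∃-syntax; ∃₂; _×_; _,_; proj₁; proj₂)
open import Data.Product.Function.NonDependent.Propositional using (_×-↔_)
open import Data.Rational.Base as ℚ using (ℚ)
open import Data.Sum.Base as Sum using (_⊎_; inj₁; inj₂; [_,_])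
open import Data.Sum.Function.Propositional using (_⊎-↔_)
open import Data.Unit.Base using (⊤; tt)
open import Function.Base using (_∘_)
open import Function.Bundles using (_↔_; _⇔_; Inverse; Equivalence; mk⇔)
open import Function.Properties.Inverse using (↔-refl; ↔-trans)
open import Relation.Binary.PropositionalEquality as ≡ using (_≡_; _≢_; refl)
open import Relation.Nullary.Decidable using (Dec; yes; no)

module _ {c ℓ} {R : CommutativeRing c ℓ} where
  open CommutativeRing R using (Carrier; _≈_; _+_; _*_; -_; 0#; trans; reflexive)

  infixl 6 _⊖_

  _⊖_ : ∀ {V} → Poly R V → Poly R V → Poly R V
  p ⊖ q = p ⊕ (⊝ q)

  rename : ∀ {V W} → (V → W) → Poly R V → Poly R W
  rename f (con a) = con a
  rename f (var v) = var (f v)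
  rename f (p ⊕ q) = rename f p ⊕ rename f q
  rename f (p ⊗ q) = rename f p ⊗ rename f q
  rename f (⊝ p)   = ⊝ rename f p

  eval-rename : ∀ {V W} {ρ : W → Carrier} {f : V → W} {σ : V → Carrier} →
                (∀ v → ρ (f v) ≡ σ v) → ∀ p → eval R ρ (rename f p) ≡ eval R σ p
  eval-rename ρ∘f≗σ (con a) = refl
  eval-rename ρ∘f≗σ (var v) = ρ∘f≗σ v
  eval-rename ρ∘f≗σ (p ⊕ q) = ≡.cong₂ _+_ (eval-rename ρ∘f≗σ p) (eval-rename ρ∘f≗σ q)
  eval-rename ρ∘f≗σ (p ⊗ q) = ≡.cong₂ _*_ (eval-rename ρ∘f≗σ p) (eval-rename ρ∘f≗σ q)
  eval-rename ρ∘f≗σ (⊝ p)   = ≡.cong -_ (eval-rename ρ∘f≗σ p)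

  HasSolution : ∀ {m} {W J : Set} → (J → Poly R (Fin m ⊎ W)) → (Fin m → Carrier) → Set (c ⊔ ℓ)
  HasSolution {W = W} F a = Σ (W → Carrier) λ y → ∀ j → eval R [ a , y ] (F j) ≈ 0#

  diophantine-resp-⇔ : ∀ {m p p′} {S : (Fin m → Carrier) → Set p} {S′ : (Fin m → Carrier) → Set p′} →
                       (∀ a → S a ⇔ S′ a) → Diophantine R m S → Diophantine R m S′
  diophantine-resp-⇔ S⇔S′ (n , r , F , spec) = n , r , F , λ a →
    proj₁ (spec a) ∘ Equivalence.from (S⇔S′ a) , Equivalence.to (S⇔S′ a) ∘ proj₂ (spec a)

  hasSolution-diophantine : ∀ {m n r} {W J : Set} → Fin n ↔ W → Fin r ↔ J →
                            (F : J → Poly R (Fin m ⊎ W)) → Diophantine R m (HasSolution F)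
  hasSolution-diophantine {m} {n} {r} W↔ J↔ F = n , r , F′ , λ a → forth a , back a
    where
    module W = Inverse W↔
    module J = Inverse J↔

    F′ : Fin r → Poly R (Fin m ⊎ Fin n)
    F′ i = rename (Sum.map₂ W.from) (F (J.to i))

    forth : ∀ a → HasSolution F a → HasSolution F′ a
    forth a (y , y-solves) = y ∘ W.to , λ i → trans
      (reflexive (eval-rename (λ { (inj₁ _) → refl ; (inj₂ w) → ≡.cong y (W.strictlyInverseˡ w) })
                              (F (J.to i))))
      (y-solves (J.to i))

    back : ∀ a → HasSolution F′ a → HasSolution F a
    back a (y , y-solves) = y ∘ W.from , λ j →
      ≡.subst (λ j → eval R [ a , y ∘ W.from ] (F j) ≈ 0#) (J.strictlyInverseˡ j) (trans
        (reflexive (≡.sym (eval-rename (λ { (inj₁ _) → refl ; (inj₂ _) → refl })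
                                       (F (J.to (J.from j))))))
        (y-solves (J.from j)))

  ConstrainedSolution : ∀ {m k l s} {J : Set} → ((Fin 1 → Carrier) → Set s) →
                        (J → Poly R (Fin m ⊎ (Fin k ⊎ Fin l))) → (Fin m → Carrier) → Set (c ⊔ ℓ ⊔ s)
  ConstrainedSolution {k = k} {l} S E a = Σ (Fin k ⊎ Fin l → Carrier) λ y →
    (∀ i → S (λ _ → y (inj₁ i))) × (∀ j → eval R [ a , y ] (E j) ≈ 0#)

  -- Each constrained unknown gets its own copy of the system defining S.
  diophantine-constrained : ∀ {m k l e s} {S : (Fin 1 → Carrier) → Set s} → Diophantine R 1 S →
                            (E : Fin e → Poly R (Fin m ⊎ (Fin k ⊎ Fin l))) →
                            Diophantine R m (ConstrainedSolution S E)
  diophantine-constrained {m} {k} {l} {e} {S = S} (n , r , F , spec) E =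
    diophantine-resp-⇔ (λ a → mk⇔ (back a) (forth a))
      (hasSolution-diophantine (↔-trans Fin.+↔⊎ (Fin.+↔⊎ ⊎-↔ Fin.*↔×))
                               (↔-trans Fin.+↔⊎ (↔-refl ⊎-↔ Fin.*↔×)) G)
    where
    copy : Fin k → Fin 1 ⊎ Fin n → Fin m ⊎ ((Fin k ⊎ Fin l) ⊎ (Fin k × Fin n))
    copy i = [ (λ _ → inj₂ (inj₁ (inj₁ i))) , (λ v → inj₂ (inj₂ (i , v))) ]

    G : Fin e ⊎ (Fin k × Fin r) → Poly R (Fin m ⊎ ((Fin k ⊎ Fin l) ⊎ (Fin k × Fin n)))
    G (inj₁ j)       = rename (Sum.map₂ inj₁) (E j)
    G (inj₂ (i , j)) = rename (copy i) (F j)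

    eval-G-inj₁ : ∀ a ρ j → eval R [ a , ρ ] (G (inj₁ j)) ≡ eval R [ a , ρ ∘ inj₁ ] (E j)
    eval-G-inj₁ a ρ j = eval-rename (λ { (inj₁ _) → refl ; (inj₂ _) → refl }) (E j)

    eval-G-inj₂ : ∀ a ρ i j → eval R [ a , ρ ] (G (inj₂ (i , j))) ≡
                              eval R [ (λ _ → ρ (inj₁ (inj₁ i))) , (λ v → ρ (inj₂ (i , v))) ] (F j)
    eval-G-inj₂ a ρ i j = eval-rename (λ { (inj₁ _) → refl ; (inj₂ _) → refl }) (F j)

    forth : ∀ a → ConstrainedSolution S E a → HasSolution G a
    forth a (y , y∈S , y-solves) = [ y , w ] , λ
      { (inj₁ j)       → trans (reflexive (eval-G-inj₁ a [ y , w ] j)) (y-solves j)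
      ; (inj₂ (i , j)) → trans (reflexive (eval-G-inj₂ a [ y , w ] i j)) (proj₂ (witness i) j)
      }
      where
      witness : ∀ i → Σ (Fin n → Carrier) λ z → ∀ j → eval R [ (λ _ → y (inj₁ i)) , z ] (F j) ≈ 0#
      witness i = proj₁ (spec (λ _ → y (inj₁ i))) (y∈S i)
      w : Fin k × Fin n → Carrier
      w (i , v) = proj₁ (witness i) v

    back : ∀ a → HasSolution G a → ConstrainedSolution S E a
    back a (ρ , ρ-solves) = ρ ∘ inj₁ ,
      (λ i → proj₂ (spec _) ((λ v → ρ (inj₂ (i , v))) ,
        λ j → trans (reflexive (≡.sym (eval-G-inj₂ a ρ i j))) (ρ-solves (inj₂ (i , j))))) ,
      λ j → trans (reflexive (≡.sym (eval-G-inj₁ a ρ j))) (ρ-solves (inj₁ j))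

record Difference {s} (S : ℕ → Set s) (d : ℕ) : Set s where
  field
    larger smaller   : ℕ
    larger∈S         : S larger
    smaller∈S        : S smaller
    larger≡smaller+d : larger ≡ smaller ℕ.+ d

SimultaneousDifferences : ∀ {s} → (ℕ → Set s) → ℕ → ℕ → Set s
SimultaneousDifferences S P D = ∃[ c ] 0 ℕ.< c × Difference S (c ℕ.* P) × Difference S (c ℕ.* D)

module _ where
  open import Data.List.Membership.Propositional.Properties using (∈-lookup)
  open import Data.List.Relation.Unary.All as All using (All)
  open import Data.List.Relation.Unary.AllPairs using (_∷_)
  open import Data.List.Relation.Unary.Unique.Propositional using (Unique)
  open import Data.Nat.Base
  open import Data.Nat.Properties
  open import Data.Nat.Solver using (module +-*-Solver)
  open import Data.Product.Properties using (,-injectiveˡ; ,-injectiveʳ)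
  open import Relation.Binary.Definitions using (tri<; tri≈; tri>)
  open import Relation.Nullary.Negation using (contradiction)
  open ≡ using (sym; trans; cong; cong₂)

  pigeonhole-↔ : ∀ {a b m n} {A : Set a} {B : Set b} → m < n →
                 Fin n ↔ A → Fin m ↔ B → (f : A → B) → ∃₂ λ x y → x ≢ y × f x ≡ f y
  pigeonhole-↔ m<n A↔ B↔ f =
    let i , j , i<j , eq = Fin.pigeonhole m<n (B.from ∘ f ∘ A.to) in
    A.to i , A.to j ,
    (λ eq′ → Fin.<⇒≢ i<j (trans (sym (A.strictlyInverseʳ i))
                                (trans (cong A.from eq′) (A.strictlyInverseʳ j)))) ,
    trans (sym (B.strictlyInverseˡ _)) (trans (cong B.to eq) (B.strictlyInverseˡ _))
    where
    module A = Inverse A↔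
    module B = Inverse B↔

  lookup-injective : ∀ {a} {A : Set a} {xs : List A} → Unique xs →
                     ∀ {i j} → List.lookup xs i ≡ List.lookup xs j → i ≡ j
  lookup-injective (_ ∷ _)   {0F}        {0F}        _  = refl
  lookup-injective (x∉ ∷ _)  {0F}        {Fin.suc j} eq = ⊥-elim (All.lookup x∉ (∈-lookup j) eq)
  lookup-injective (x∉ ∷ _)  {Fin.suc i} {0F}        eq = ⊥-elim (All.lookup x∉ (∈-lookup i) (sym eq))
  lookup-injective (_ ∷ xs!) {Fin.suc i} {Fin.suc j} eq = cong Fin.suc (lookup-injective xs! eq)

  a+jq≡b+kq⇒a≡b+[k∸j]q : ∀ {a b j k} q → j ≤ k → a + j * q ≡ b + k * q → a ≡ b + (k ∸ j) * q
  a+jq≡b+kq⇒a≡b+[k∸j]q {a} {b} {j} {k} q j≤k eq = +-cancelʳ-≡ (j * q) a (b + (k ∸ j) * q) (begin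
    a + j * q                 ≡⟨ eq ⟩
    b + k * q                 ≡⟨ cong (λ i → b + i * q) (m∸n+n≡m j≤k) ⟨
    b + (k ∸ j + j) * q       ≡⟨ cong (b +_) (*-distribʳ-+ q (k ∸ j) j) ⟩
    b + ((k ∸ j) * q + j * q) ≡⟨ +-assoc b _ _ ⟨
    b + (k ∸ j) * q + j * q   ∎)
    where open ≡.≡-Reasoning

  module _ {s} {S : ℕ → Set s} {x : ℕ} {l : List ℕ}
           (unique : Unique l) (sample : All (λ n → n ≤ x × S n) l) where

    private
      L = length l

      element : Fin L → ℕ
      element = List.lookup l

      element≤x : ∀ i → element i ≤ x
      element≤x i = proj₁ (All.lookup sample (∈-lookup i))

      element∈S : ∀ i → S (element i)
      element∈S i = proj₂ (All.lookup sample (∈-lookup i))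

    shifted : ∀ K q → Fin (suc K) → Fin L → Fin (suc (x + K * q))
    shifted K q j i = fromℕ< (s≤s (+-mono-≤ (element≤x i) (*-monoˡ-≤ q (Fin.toℕ≤pred[n] j))))

    shifted-≡ : ∀ K q j j′ {i i′} → shifted K q j i ≡ shifted K q j′ i′ →
                element i + toℕ j * q ≡ element i′ + toℕ j′ * q
    shifted-≡ _ _ _ _ eq = trans (sym (Fin.toℕ-fromℕ< _)) (trans (cong toℕ eq) (Fin.toℕ-fromℕ< _))

    shift-difference : ∀ {q j j′ i i′} → j < j′ → element i + j * q ≡ element i′ + j′ * q →
                       Difference S ((j′ ∸ j) * q)
    shift-difference {q} {i = i} {i′} j<j′ eq = record
      { larger           = element i
      ; smaller          = element i′
      ; larger∈S         = element∈S i
      ; smaller∈S        = element∈S i′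
      ; larger≡smaller+d = a+jq≡b+kq⇒a≡b+[k∸j]q q (<⇒≤ j<j′) eq
      }

    collision⇒simultaneousDifferences :
      ∀ {K P D} {j j′ : Fin (suc K)} {u u′ v v′ : Fin L} → (j , u , v) ≢ (j′ , u′ , v′) →
      element u + toℕ j * P ≡ element u′ + toℕ j′ * P →
      element v + toℕ j * D ≡ element v′ + toℕ j′ * D →
      SimultaneousDifferences S P D
    collision⇒simultaneousDifferences {P = P} {D} {j} {j′} distinct eqP eqD with Fin.<-cmp j j′
    ... | tri< j<j′ _ _ =
      toℕ j′ ∸ toℕ j , m<n⇒0<n∸m j<j′ , shift-difference j<j′ eqP , shift-difference j<j′ eqD
    ... | tri> _ _ j′<j =
      toℕ j ∸ toℕ j′ , m<n⇒0<n∸m j′<j , shift-difference j′<j (sym eqP) , shift-difference j′<j (sym eqD)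
    ... | tri≈ _ refl _ = ⊥-elim (distinct (cong (j ,_) (cong₂ _,_
      (lookup-injective unique (+-cancelʳ-≡ (toℕ j * P) _ _ eqP))
      (lookup-injective unique (+-cancelʳ-≡ (toℕ j * D) _ _ eqD)))))

    pigeonhole-differences : ∀ K P D → suc (x + K * P) * suc (x + K * D) < suc K * (L * L) →
                             SimultaneousDifferences S P D
    pigeonhole-differences K P D crowded
      with pigeonhole-↔ crowded (↔-trans Fin.*↔× (↔-refl ×-↔ Fin.*↔×)) Fin.*↔×
             (λ (j , u , v) → shifted K P j u , shifted K D j v)
    ... | (j , _) , (j′ , _) , distinct , eq = collision⇒simultaneousDifferences distinct
      (shifted-≡ K P j j′ (,-injectiveˡ eq)) (shifted-≡ K D j j′ (,-injectiveʳ eq))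

  suc[x+a]≤x+x : ∀ {x a} → a < x → suc (x + a) ≤ x + x
  suc[x+a]≤x+x {x} {a} a<x = ≤-trans (≤-reflexive (sym (+-suc x a))) (+-monoʳ-≤ x a<x)

  box<pairs : ∀ b L {x A B} → x ≤ b * L → 0 < x → A < x → B < x →
              suc (x + A) * suc (x + B) < suc ((b + b) * (b + b)) * (L * L)
  box<pairs b zero x≤b*0 0<x _ _ =
    contradiction (≤-trans x≤b*0 (≤-reflexive (*-zeroʳ b))) (<⇒≱ 0<x)
  box<pairs b L@(suc _) {x} {A} {B} x≤bL _ A<x B<x = begin-strict
    suc (x + A) * suc (x + B)           ≤⟨ *-mono-≤ (suc[x+a]≤x+x A<x) (suc[x+a]≤x+x B<x) ⟩
    (x + x) * (x + x)                   ≤⟨ *-mono-≤ 2x≤2bL 2x≤2bL ⟩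
    ((b + b) * L) * ((b + b) * L)       ≡⟨ interchange ⟩
    (b + b) * (b + b) * (L * L)         <⟨ m<n+m _ (s≤s z≤n) ⟩
    suc ((b + b) * (b + b)) * (L * L)   ∎
    where
    open ≤-Reasoning
    2x≤2bL : x + x ≤ (b + b) * L
    2x≤2bL = ≤-trans (+-mono-≤ x≤bL x≤bL) (≤-reflexive (sym (*-distribʳ-+ L b b)))
    interchange : ((b + b) * L) * ((b + b) * L) ≡ (b + b) * (b + b) * (L * L)
    interchange = solve 2 (λ c l → (c :* l) :* (c :* l) := (c :* c) :* (l :* l)) refl (b + b) L
      where open +-*-Solver

  positiveLowerDensity⇒simultaneousDifferences : ∀ {s} {S : ℕ → Set s} → PositiveLowerDensity S →
                                                 ∀ P D → SimultaneousDifferences S P D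
  positiveLowerDensity⇒simultaneousDifferences {S = S} (a , b , N , 1≤a , dense) P D =
    fromSample (dense x N≤x)
    where
    K = (b + b) * (b + b)
    x = suc (N + K * P + K * D)

    N≤x : N ≤ x
    N≤x = m≤n⇒m≤1+n (≤-trans (m≤m+n N (K * P)) (m≤m+n _ (K * D)))

    fromSample : ∃[ k ] AtLeastUpTo S x k × a * x ≤ b * k → SimultaneousDifferences S P D
    fromSample (k , (l , unique , sample , k≤L) , ax≤bk) =
      pigeonhole-differences unique sample K P D (box<pairs b (length l) x≤bL (s≤s z≤n) KP<x KD<x)
      where
      open ≤-Reasoning
      x≤bL : x ≤ b * length l
      x≤bL = begin
        x            ≤⟨ m≤n*m x a {{>-nonZero 1≤a}} ⟩
        a * x        ≤⟨ ax≤bk ⟩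
        b * k        ≤⟨ *-monoʳ-≤ b k≤L ⟩
        b * length l ∎
      KP<x : K * P < x
      KP<x = s≤s (≤-trans (m≤n+m (K * P) N) (m≤m+n _ (K * D)))
      KD<x : K * D < x
      KD<x = s≤s (m≤n+m (K * D) (N + K * P))

record QuotientOfDifferences {t} (T : ℚ → Set t) (q : ℚ) : Set t where
  field
    t₀ t₁ t₂ t₃     : ℚ
    t₀∈T            : T t₀
    t₁∈T            : T t₁
    t₂∈T            : T t₂
    t₃∈T            : T t₃
    t₂-t₃≢0         : t₂ ℚ.- t₃ ≢ ℚ.0ℚ
    q*[t₂-t₃]≡t₀-t₁ : q ℚ.* (t₂ ℚ.- t₃) ≡ t₀ ℚ.- t₁

module _ where
  open import Data.Integer.Base as ℤ using (ℤ; +_; -[1+_])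
  open import Data.Rational.Base
  open import Data.Rational.Properties
  open import Algebra.Properties.AbelianGroup +-0-abelianGroup using (⁻¹-anti-homo‿-)
  open import Data.Rational.Solver using (module +-*-Solver)
  open import Data.Rational.Unnormalised.Base as ℚᵘ using (mkℚᵘ; *≡*) renaming (_≃_ to _≃ᵘ_)
  import Data.Rational.Unnormalised.Properties as ℚᵘ
  import Data.Integer.Properties as ℤ
  import Data.Nat.Properties as ℕ
  open ≡ using (sym; trans; cong; cong₂)
  open +-*-Solver

  toℚᵘ-ℕ→ℚ : ∀ n → toℚᵘ (ℕ→ℚ n) ≃ᵘ mkℚᵘ (+ n) 0
  toℚᵘ-ℕ→ℚ n = toℚᵘ-fromℚᵘ (mkℚᵘ (+ n) 0)

  ℕ→ℚ≢0 : ∀ n → ℕ→ℚ (suc n) ≢ 0ℚ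
  ℕ→ℚ≢0 n eq with ℚᵘ.≃-trans (ℚᵘ.≃-sym (toℚᵘ-ℕ→ℚ (suc n))) (ℚᵘ.≃-reflexive (cong toℚᵘ eq))
  ... | *≡* ()

  ℕ→ℚ-homo-+ : ∀ m n → ℕ→ℚ (m ℕ.+ n) ≡ ℕ→ℚ m + ℕ→ℚ n
  ℕ→ℚ-homo-+ m n = toℚᵘ-injective (begin
    toℚᵘ (ℕ→ℚ (m ℕ.+ n))                 ≈⟨ toℚᵘ-ℕ→ℚ (m ℕ.+ n) ⟩
    mkℚᵘ (+ (m ℕ.+ n)) 0                  ≈⟨ *≡* (cong (ℤ._* + 1) (trans (ℤ.pos-+ m n)
                                                (sym (cong₂ ℤ._+_ (ℤ.*-identityʳ (+ m)) (ℤ.*-identityʳ (+ n)))))) ⟩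
    mkℚᵘ (+ m) 0 ℚᵘ.+ mkℚᵘ (+ n) 0        ≈⟨ ℚᵘ.+-cong (toℚᵘ-ℕ→ℚ m) (toℚᵘ-ℕ→ℚ n) ⟨
    toℚᵘ (ℕ→ℚ m) ℚᵘ.+ toℚᵘ (ℕ→ℚ n)        ≈⟨ toℚᵘ-homo-+ (ℕ→ℚ m) (ℕ→ℚ n) ⟨
    toℚᵘ (ℕ→ℚ m + ℕ→ℚ n)                  ∎)
    where open ℚᵘ.≃-Reasoning

  ℕ→ℚ-homo-* : ∀ m n → ℕ→ℚ (m ℕ.* n) ≡ ℕ→ℚ m * ℕ→ℚ n
  ℕ→ℚ-homo-* m n = toℚᵘ-injective (begin
    toℚᵘ (ℕ→ℚ (m ℕ.* n))                 ≈⟨ toℚᵘ-ℕ→ℚ (m ℕ.* n) ⟩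
    mkℚᵘ (+ (m ℕ.* n)) 0                  ≈⟨ *≡* (cong (ℤ._* + 1) (ℤ.pos-* m n)) ⟩
    mkℚᵘ (+ m) 0 ℚᵘ.* mkℚᵘ (+ n) 0        ≈⟨ ℚᵘ.*-cong (toℚᵘ-ℕ→ℚ m) (toℚᵘ-ℕ→ℚ n) ⟨
    toℚᵘ (ℕ→ℚ m) ℚᵘ.* toℚᵘ (ℕ→ℚ n)        ≈⟨ toℚᵘ-homo-* (ℕ→ℚ m) (ℕ→ℚ n) ⟨
    toℚᵘ (ℕ→ℚ m * ℕ→ℚ n)                  ∎)
    where open ℚᵘ.≃-Reasoning

  p*↧p≡↥p : ∀ p → p * ℕ→ℚ (↧ₙ p) ≡ ↥ p / 1
  p*↧p≡↥p p@(mkℚ n d-1 _) = toℚᵘ-injective (begin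
    toℚᵘ (p * ℕ→ℚ (suc d-1))                ≈⟨ toℚᵘ-homo-* p (ℕ→ℚ (suc d-1)) ⟩
    mkℚᵘ n d-1 ℚᵘ.* toℚᵘ (ℕ→ℚ (suc d-1))    ≈⟨ ℚᵘ.*-congˡ {mkℚᵘ n d-1} (toℚᵘ-ℕ→ℚ (suc d-1)) ⟩
    mkℚᵘ n d-1 ℚᵘ.* mkℚᵘ (+ suc d-1) 0      ≈⟨ *≡* (trans (ℤ.*-identityʳ _)
                                                 (cong (λ k → n ℤ.* + suc k) (sym (ℕ.*-identityʳ d-1)))) ⟩
    mkℚᵘ n 0                                ≈⟨ toℚᵘ-fromℚᵘ (mkℚᵘ n 0) ⟨
    toℚᵘ (n / 1)                            ∎)
    where open ℚᵘ.≃-Reasoning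

  p*ℕ→ℚ[c*↧p]≡c*↥p : ∀ p c → p * ℕ→ℚ (c ℕ.* ↧ₙ p) ≡ ℕ→ℚ c * (↥ p / 1)
  p*ℕ→ℚ[c*↧p]≡c*↥p p c = begin
    p * ℕ→ℚ (c ℕ.* ↧ₙ p)            ≡⟨ cong (p *_) (ℕ→ℚ-homo-* c (↧ₙ p)) ⟩
    p * (ℕ→ℚ c * ℕ→ℚ (↧ₙ p))        ≡⟨ solve 3 (λ p c d → p :* (c :* d) := c :* (p :* d))
                                                refl p (ℕ→ℚ c) (ℕ→ℚ (↧ₙ p)) ⟩
    ℕ→ℚ c * (p * ℕ→ℚ (↧ₙ p))        ≡⟨ cong (ℕ→ℚ c *_) (p*↧p≡↥p p) ⟩
    ℕ→ℚ c * (↥ p / 1)               ∎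
    where open ≡.≡-Reasoning

  ℕ→ℚ-difference : ∀ {s} {S : ℕ → Set s} {d} (δ : Difference S d) →
                   ℕ→ℚ (Difference.larger δ) - ℕ→ℚ (Difference.smaller δ) ≡ ℕ→ℚ d
  ℕ→ℚ-difference {d = d} record { smaller = s ; larger≡smaller+d = refl } = begin
    ℕ→ℚ (s ℕ.+ d) - ℕ→ℚ s       ≡⟨ cong (_- ℕ→ℚ s) (ℕ→ℚ-homo-+ s d) ⟩
    ℕ→ℚ s + ℕ→ℚ d - ℕ→ℚ s      ≡⟨ solve 2 (λ s d → s :+ d :- s := d) refl (ℕ→ℚ s) (ℕ→ℚ d) ⟩
    ℕ→ℚ d                       ∎
    where open ≡.≡-Reasoning

  ℕ→ℚ-difference≢0 : ∀ {s} {S : ℕ → Set s} {d} → 0 ℕ.< d → (δ : Difference S d) →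
                     ℕ→ℚ (Difference.larger δ) - ℕ→ℚ (Difference.smaller δ) ≢ 0ℚ
  ℕ→ℚ-difference≢0 {d = suc d} (s≤s z≤n) δ = ℕ→ℚ≢0 d ∘ trans (sym (ℕ→ℚ-difference δ))

  module _ {t} {T : ℚ → Set t} (q : ℚ) where
    open Difference
    open ≡.≡-Reasoning

    -- z stands for ↥ q, generalised so that its sign can be split on.
    differences⇒quotientOfDifferences : ∀ {c} (z : ℤ) → 0 ℕ.< c →
      q * ℕ→ℚ (c ℕ.* ↧ₙ q) ≡ ℕ→ℚ c * (z / 1) →
      Difference (T ∘ ℕ→ℚ) (c ℕ.* ℤ.∣ z ∣) → Difference (T ∘ ℕ→ℚ) (c ℕ.* ↧ₙ q) →
      QuotientOfDifferences T q
    differences⇒quotientOfDifferences {c} (+ n) (s≤s z≤n) scaled δ δ′ = record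
      { t₀ = ℕ→ℚ (larger δ) ; t₁ = ℕ→ℚ (smaller δ) ; t₂ = ℕ→ℚ (larger δ′) ; t₃ = ℕ→ℚ (smaller δ′)
      ; t₀∈T = larger∈S δ ; t₁∈T = smaller∈S δ ; t₂∈T = larger∈S δ′ ; t₃∈T = smaller∈S δ′
      ; t₂-t₃≢0 = ℕ→ℚ-difference≢0 (s≤s z≤n) δ′
      ; q*[t₂-t₃]≡t₀-t₁ = begin
          q * (ℕ→ℚ (larger δ′) - ℕ→ℚ (smaller δ′)) ≡⟨ cong (q *_) (ℕ→ℚ-difference δ′) ⟩
          q * ℕ→ℚ (c ℕ.* ↧ₙ q)                      ≡⟨ scaled ⟩
          ℕ→ℚ c * ℕ→ℚ n                             ≡⟨ ℕ→ℚ-homo-* c n ⟨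
          ℕ→ℚ (c ℕ.* n)                             ≡⟨ ℕ→ℚ-difference δ ⟨
          ℕ→ℚ (larger δ) - ℕ→ℚ (smaller δ)         ∎
      }
    differences⇒quotientOfDifferences {c} -[1+ n ] (s≤s z≤n) scaled δ δ′ = record
      { t₀ = ℕ→ℚ (smaller δ) ; t₁ = ℕ→ℚ (larger δ) ; t₂ = ℕ→ℚ (larger δ′) ; t₃ = ℕ→ℚ (smaller δ′)
      ; t₀∈T = smaller∈S δ ; t₁∈T = larger∈S δ ; t₂∈T = larger∈S δ′ ; t₃∈T = smaller∈S δ′
      ; t₂-t₃≢0 = ℕ→ℚ-difference≢0 (s≤s z≤n) δ′
      ; q*[t₂-t₃]≡t₀-t₁ = begin
          q * (ℕ→ℚ (larger δ′) - ℕ→ℚ (smaller δ′)) ≡⟨ cong (q *_) (ℕ→ℚ-difference δ′) ⟩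
          q * ℕ→ℚ (c ℕ.* ↧ₙ q)                      ≡⟨ scaled ⟩
          ℕ→ℚ c * - ℕ→ℚ (suc n)                     ≡⟨ neg-distribʳ-* (ℕ→ℚ c) (ℕ→ℚ (suc n)) ⟨
          - (ℕ→ℚ c * ℕ→ℚ (suc n))                   ≡⟨ cong -_ (ℕ→ℚ-homo-* c (suc n)) ⟨
          - ℕ→ℚ (c ℕ.* suc n)                       ≡⟨ cong -_ (ℕ→ℚ-difference δ) ⟨
          - (ℕ→ℚ (larger δ) - ℕ→ℚ (smaller δ))     ≡⟨ ⁻¹-anti-homo‿- (ℕ→ℚ (larger δ)) _ ⟩
          ℕ→ℚ (smaller δ) - ℕ→ℚ (larger δ)         ∎
      }

  positiveLowerDensity⇒quotientOfDifferences : ∀ {t} {T : ℚ → Set t} →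
    PositiveLowerDensity (T ∘ ℕ→ℚ) → ∀ q → QuotientOfDifferences T q
  positiveLowerDensity⇒quotientOfDifferences dense q =
    let c , 0<c , δ , δ′ = positiveLowerDensity⇒simultaneousDifferences dense ℤ.∣ ↥ q ∣ (↧ₙ q) in
    differences⇒quotientOfDifferences q (↥ q) 0<c (p*ℕ→ℚ[c*↧p]≡c*↥p q c) δ δ′

module _ {c ℓ} (A : ℚAlgebra c ℓ) where
  open ℚAlgebra A renaming (refl to ≈-refl)
  open import Data.Rational.Base using (0ℚ; 1ℚ; 1/_; ≢-nonZero)
  open import Data.Vec.Functional using (_∷_; [])
  import Data.Rational.Properties as ℚ
  open RingMorphisms.IsRingHomomorphism ι-isRingHom using (+-homo; *-homo; -‿homo; 0#-homo; 1#-homo)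
  open import Algebra.Properties.Ring (CommutativeRing.ring commRing) using (x∙y⁻¹≈ε⇒x≈y; x≈y⇒x∙y⁻¹≈ε)
  open import Relation.Binary.Reasoning.Setoid setoid

  private
    x z : Poly commRing (Fin 1 ⊎ (Fin 4 ⊎ Fin 1))
    x = var (inj₁ 0F)
    z = var (inj₂ (inj₂ 0F))
    y : Fin 4 → Poly commRing (Fin 1 ⊎ (Fin 4 ⊎ Fin 1))
    y i = var (inj₂ (inj₁ i))

  quotientEquations : Fin 2 → Poly commRing (Fin 1 ⊎ (Fin 4 ⊎ Fin 1))
  quotientEquations 0F = ((y 2F ⊖ y 3F) ⊗ z) ⊖ con 1#
  quotientEquations 1F = (x ⊗ (y 2F ⊖ y 3F)) ⊖ (y 0F ⊖ y 1F)

  ι-homo-difference : ∀ p q → ι (p ℚ.- q) ≈ ι p + - ι q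
  ι-homo-difference p q = trans (+-homo p (ℚ.- q)) (+-congˡ (-‿homo q))

  1#≈0#⇒x≈0# : 1# ≈ 0# → ∀ x → x ≈ 0#
  1#≈0#⇒x≈0# 1≈0 x = begin
    x       ≈⟨ *-identityʳ x ⟨
    x * 1#  ≈⟨ *-congˡ 1≈0 ⟩
    x * 0#  ≈⟨ zeroʳ x ⟩
    0#      ∎

  module _ {s} {T : ℚ → Set s} (quotient : ∀ q → QuotientOfDifferences T q) where

    rational⇒quotientSolution : ∀ a → ImageIn A (λ _ → ⊤) a →
                                ConstrainedSolution (ImageIn A T) quotientEquations a
    rational⇒quotientSolution a (q , _ , ιq≈a) = [ ι ∘ (t₀ ∷ t₁ ∷ t₂ ∷ t₃ ∷ []) , (λ _ → ι w) ] ,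
      (λ { 0F → t₀ , t₀∈T , ≈-refl ; 1F → t₁ , t₁∈T , ≈-refl
         ; 2F → t₂ , t₂∈T , ≈-refl ; 3F → t₃ , t₃∈T , ≈-refl }) ,
      λ { 0F → x≈y⇒x∙y⁻¹≈ε inverse ; 1F → x≈y⇒x∙y⁻¹≈ε scaled }
      where
      open QuotientOfDifferences (quotient q)
      instance _ = ≢-nonZero t₂-t₃≢0
      w = 1/ (t₂ ℚ.- t₃)
      inverse : (ι t₂ + - ι t₃) * ι w ≈ 1#
      inverse = begin
        (ι t₂ + - ι t₃) * ι w    ≈⟨ *-congʳ (ι-homo-difference t₂ t₃) ⟨
        ι (t₂ ℚ.- t₃) * ι w      ≈⟨ *-homo (t₂ ℚ.- t₃) w ⟨
        ι ((t₂ ℚ.- t₃) ℚ.* w)    ≡⟨ ≡.cong ι (ℚ.*-inverseʳ (t₂ ℚ.- t₃)) ⟩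
        ι 1ℚ                     ≈⟨ 1#-homo ⟩
        1#                       ∎
      scaled : a 0F * (ι t₂ + - ι t₃) ≈ ι t₀ + - ι t₁
      scaled = begin
        a 0F * (ι t₂ + - ι t₃)   ≈⟨ *-cong ιq≈a (ι-homo-difference t₂ t₃) ⟨
        ι q * ι (t₂ ℚ.- t₃)      ≈⟨ *-homo q (t₂ ℚ.- t₃) ⟨
        ι (q ℚ.* (t₂ ℚ.- t₃))    ≡⟨ ≡.cong ι q*[t₂-t₃]≡t₀-t₁ ⟩
        ι (t₀ ℚ.- t₁)            ≈⟨ ι-homo-difference t₀ t₁ ⟩
        ι t₀ + - ι t₁            ∎

    quotientSolution⇒rational : ∀ a → ConstrainedSolution (ImageIn A T) quotientEquations a →
                                ImageIn A (λ _ → ⊤) a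
    quotientSolution⇒rational a (u , u∈ιT , solves) = byCases (d ℚ.≟ 0ℚ)
      where
      t : Fin 4 → ℚ
      t i = proj₁ (u∈ιT i)
      ιt≈u : ∀ i → ι (t i) ≈ u (inj₁ i)
      ιt≈u i = proj₂ (proj₂ (u∈ιT i))
      ι[tᵢ-tⱼ]≈uᵢ-uⱼ : ∀ i j → ι (t i ℚ.- t j) ≈ u (inj₁ i) + - u (inj₁ j)
      ι[tᵢ-tⱼ]≈uᵢ-uⱼ i j = trans (ι-homo-difference (t i) (t j)) (+-cong (ιt≈u i) (-‿cong (ιt≈u j)))

      d = t 2F ℚ.- t 3F
      w = u (inj₂ 0F)

      ιd*w≈1 : ι d * w ≈ 1#
      ιd*w≈1 = trans (*-congʳ (ι[tᵢ-tⱼ]≈uᵢ-uⱼ 2F 3F)) (x∙y⁻¹≈ε⇒x≈y _ _ (solves 0F))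

      ι[t₀-t₁]≈a*ιd : ι (t 0F ℚ.- t 1F) ≈ a 0F * ι d
      ι[t₀-t₁]≈a*ιd = begin
        ι (t 0F ℚ.- t 1F)                  ≈⟨ ι[tᵢ-tⱼ]≈uᵢ-uⱼ 0F 1F ⟩
        u (inj₁ 0F) + - u (inj₁ 1F)        ≈⟨ x∙y⁻¹≈ε⇒x≈y _ _ (solves 1F) ⟨
        a 0F * (u (inj₁ 2F) + - u (inj₁ 3F)) ≈⟨ *-congˡ (ι[tᵢ-tⱼ]≈uᵢ-uⱼ 2F 3F) ⟨
        a 0F * ι d                         ∎

      byCases : Dec (d ≡ 0ℚ) → ImageIn A (λ _ → ⊤) a
      byCases (yes d≡0) = 0ℚ , tt , trans 0#-homo (sym (1#≈0#⇒x≈0# 1≈0 (a 0F)))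
        where
        1≈0 : 1# ≈ 0#
        1≈0 = begin
          1#          ≈⟨ ιd*w≈1 ⟨
          ι d * w     ≡⟨ ≡.cong (λ d → ι d * w) d≡0 ⟩
          ι 0ℚ * w    ≈⟨ *-congʳ 0#-homo ⟩
          0# * w      ≈⟨ zeroˡ w ⟩
          0#          ∎
      byCases (no d≢0) = (t 0F ℚ.- t 1F) ℚ.* 1/ d , tt , (begin
        ι ((t 0F ℚ.- t 1F) ℚ.* 1/ d)     ≈⟨ *-homo _ _ ⟩
        ι (t 0F ℚ.- t 1F) * ι (1/ d)     ≈⟨ *-congʳ ι[t₀-t₁]≈a*ιd ⟩
        a 0F * ι d * ι (1/ d)            ≈⟨ *-assoc _ _ _ ⟩
        a 0F * (ι d * ι (1/ d))          ≈⟨ *-congˡ (*-homo d (1/ d)) ⟨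
        a 0F * ι (d ℚ.* 1/ d)            ≡⟨ ≡.cong (λ r → a 0F * ι r) (ℚ.*-inverseʳ d) ⟩
        a 0F * ι 1ℚ                      ≈⟨ *-congˡ 1#-homo ⟩
        a 0F * 1#                        ≈⟨ *-identityʳ (a 0F) ⟩
        a 0F                             ∎)
        where instance _ = ≢-nonZero d≢0

    quotientSolution⇔rational : ∀ a → ConstrainedSolution (ImageIn A T) quotientEquations a ⇔
                                      ImageIn A (λ _ → ⊤) a
    quotientSolution⇔rational a = mk⇔ (quotientSolution⇒rational a) (rational⇒quotientSolution a)

lemma2p3 : ∀ {c ℓ t} (A : ℚAlgebra c ℓ) (T : ℚ → Set t) →
           Diophantine (ℚAlgebra.commRing A) 1 (ImageIn A T) →
           PositiveLowerDensity (λ n → T (ℕ→ℚ n)) →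
           Diophantine (ℚAlgebra.commRing A) 1 (ImageIn A (λ _ → ⊤))
lemma2p3 A T T-diophantine dense =
  diophantine-resp-⇔ (quotientSolution⇔rational A (positiveLowerDensity⇒quotientOfDifferences dense))
    (diophantine-constrained T-diophantine (quotientEquations A))
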